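{- For every $c,n>1$ there is a deterministic algorithm for the Shift Finding problem $\mathsf{ShiftFinding}_{c,n}$ that makes $O(\sqrt{cn})$ queries.
   Context: Shift Finding $\mathsf{ShiftFinding}_{c,n}$: the input is a string $P\in\{0,1\}^{(c-1)n}$ (fully known to the algorithm), and the algorithm has query access to a string $F_{s^*}$ which is the concatenation of $n-s^*$ zeros, then $P$, then $s^*$ ones, for an unknown $s^*\in[0,n]$; a query at $x\in[0,cn]$ returns $F_{s^*}(x)$. The goal is to output $s^*$ exactly; the complexity is the number of queries made to $F_{s^*}$. -}

module Defs where

open import Data.Nat using (ℕ; zero; suc; _+_; _*_; _∸_; _<ᵇ_)
open import Data.Bool using (Bool; true; false; if_then_else_)
open import Data.Vec using (Vec; []; _∷_)
open import Data.Fin using (Fin; toℕ)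

-- Positions of F_s are 0-indexed: 0, 1, ..., c*n - 1.
-- Bit 0 is `false`, bit 1 is `true`.

-- Read the x-th entry (0-indexed) of a bit vector; out of range gives `true`
-- (never used out of range in shiftString below).
vget : {k : ℕ} → Vec Bool k → ℕ → Bool
vget []       _       = true
vget (b ∷ bs) zero    = b
vget (b ∷ bs) (suc x) = vget bs x

-- F_s = 0^(n-s) P 1^s  with P of length (c-1)n, evaluated at position x.
shiftString : (c n : ℕ) → Vec Bool ((c ∸ 1) * n) → (s : ℕ) → ℕ → Bool
shiftString c n P s x =
  if x <ᵇ (n ∸ s) then false
  else if (x ∸ (n ∸ s)) <ᵇ ((c ∸ 1) * n) then vget P (x ∸ (n ∸ s))
  else true

-- Deterministic adaptive query algorithm = decision tree over positions
-- Fin m; a node queries a position and continues in the left subtree on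
-- answer 0 (false) and in the right subtree on answer 1 (true); a leaf outputs.
data QTree (m : ℕ) : Set where
  leaf  : ℕ → QTree m
  query : Fin m → QTree m → QTree m → QTree m

run : {m : ℕ} → QTree m → (Fin m → Bool) → ℕ
run (leaf o)      f = o
run (query x l r) f = if f x then run r f else run l f

cost : {m : ℕ} → QTree m → (Fin m → Bool) → ℕ
cost (leaf o)      f = 0
cost (query x l r) f = suc (if f x then cost r f else cost l f)

oracle : (c n : ℕ) → Vec Bool ((c ∸ 1) * n) → ℕ → Fin (c * n) → Bool
oracle c n P s x = shiftString c n P s (toℕ x)

-- Write F₀ for 0ⁿ P 1^ω, so that F_s x = F₀ (s + x). Two shifts t < t′ = t + m b
-- whose strings agree at all positions j b < c n would make F₀ constant along
-- t, t + m b, t + 2 m b, …, which is impossible since F₀ t = 0 and F₀ = 1 from c n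
-- on. Hence with b = ⌊√(c n)⌋, the b + 3 queries at the multiples of b determine
-- the shift within each residue class mod b, leaving at most b candidates; a
-- knockout tournament, spending one distinguishing query per eliminated
-- candidate, finds the true shift. This uses at most 2b + 3 ≤ 5b queries.
module Submission where

open import Defs
open import Data.Bool using (Bool; true; false; if_then_else_)
open import Data.Bool.Properties using (_≟_)
open import Data.Fin using (Fin; fromℕ<)
open import Data.Fin.Properties using (any?; toℕ-fromℕ<)
open import Data.List using (List; []; _∷_; length; map; filter; head; applyUpTo; upTo)
open import Data.List.Properties using (∷-injective; ≡-dec; length-map; length-applyUpTo; length-upTo)
open import Data.List.Membership.Propositional using (_∈_)
open import Data.List.Membership.Propositional.Properties
  using (∈-map⁺; ∈-applyUpTo⁺; ∈-applyUpTo⁻; ∈-upTo⁺; ∈-filter⁺; ∈-filter⁻)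
open import Data.List.Relation.Unary.All using (All; []; _∷_)
import Data.List.Relation.Unary.All as All
open import Data.List.Relation.Unary.All.Properties using (all-filter; map⁺)
open import Data.List.Relation.Unary.Any using (here; there)
open import Data.Maybe using (fromMaybe)
open import Data.Nat
  using (ℕ; zero; suc; _+_; _*_; _∸_; _^_; _<ᵇ_; _≤_; _<_; z≤n; s≤s; z<s; NonZero; >-nonZero; >-nonZero⁻¹; _%_; _/_)
open import Data.Nat.DivMod using (_mod_; m≡m%n+[m/n]*n; m%n<n; m/n≤m; m<n⇒m%n≡m)
open import Data.Nat.Properties hiding (_≟_)
open import Data.Nat.Tactic.RingSolver using (solve-∀)
open import Data.Product using (∃; _×_; _,_; proj₁; proj₂)
open import Data.Vec using (Vec)
open import Function using (_∘_)
open import Relation.Binary.Definitions using (tri<; tri≈; tri>)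
open import Relation.Binary.PropositionalEquality
open import Relation.Nullary using (Dec; yes; no; ¬_; ¬?; does; contradiction; _×-dec_)
open import Relation.Nullary.Decidable using (decidable-stable)
open import Relation.Nullary.Reflects using (det; ofʸ; ofⁿ)
open import Relation.Unary using (Decidable)

ask : ∀ {m} → Fin m → (Bool → QTree m) → QTree m
ask x k = query x (k false) (k true)

run-ask : ∀ {m} x (k : Bool → QTree m) f → run (ask x k) f ≡ run (k (f x)) f
run-ask x k f with f x
... | true  = refl
... | false = refl

cost-ask : ∀ {m} x (k : Bool → QTree m) f → cost (ask x k) f ≡ suc (cost (k (f x)) f)
cost-ask x k f with f x
... | true  = refl
... | false = refl

queryAll : ∀ {m} → List (Fin m) → (List Bool → QTree m) → QTree m
queryAll []       k = k []
queryAll (x ∷ xs) k = ask x λ v → queryAll xs (k ∘ (v ∷_))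

run-queryAll : ∀ {m} xs (k : List Bool → QTree m) f → run (queryAll xs k) f ≡ run (k (map f xs)) f
run-queryAll []       k f = refl
run-queryAll (x ∷ xs) k f =
  trans (run-ask x (λ v → queryAll xs (k ∘ (v ∷_))) f) (run-queryAll xs (k ∘ (f x ∷_)) f)

cost-queryAll : ∀ {m} xs (k : List Bool → QTree m) f →
                cost (queryAll xs k) f ≡ length xs + cost (k (map f xs)) f
cost-queryAll []       k f = refl
cost-queryAll (x ∷ xs) k f =
  trans (cost-ask x (λ v → queryAll xs (k ∘ (v ∷_))) f) (cong suc (cost-queryAll xs (k ∘ (f x ∷_)) f))

module Tournament {m} (O : ℕ → Fin m → Bool) (Valid : ℕ → Set)
                  (O-injective : ∀ {a b} → Valid a → Valid b → (∀ x → O a x ≡ O b x) → a ≡ b) where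

  distinguisher? : ∀ a b → Dec (∃ λ x → O a x ≢ O b x)
  distinguisher? a b = any? λ x → ¬? (O a x ≟ O b x)

  winner : ℕ → ℕ → Fin m → Bool → ℕ
  winner a b x v = if does (O a x ≟ v) then a else b

  knockout : ℕ → List ℕ → QTree m
  knockout a []      = leaf a
  knockout a (b ∷ L) with distinguisher? a b
  ... | yes (x , _) = ask x λ v → knockout (winner a b x v) L
  ... | no _        = knockout a L

  tournament : List ℕ → QTree m
  tournament []      = leaf 0
  tournament (a ∷ L) = knockout a L

  winner-valid : ∀ {a b} x v → Valid a → Valid b → Valid (winner a b x v)
  winner-valid {a} {b} x v va vb with does (O a x ≟ v)
  ... | true  = va
  ... | false = vb

  winner-∈ : ∀ {s a b x} L → O a x ≢ O b x → s ∈ a ∷ b ∷ L → s ∈ winner a b x (O s x) ∷ L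
  winner-∈ {a = a} {x = x} L a≢b (here refl) with O a x ≟ O a x
  ... | yes _   = here refl
  ... | no a≢a  = contradiction refl a≢a
  winner-∈ {a = a} {b} {x} L a≢b (there (here refl)) with O a x ≟ O b x
  ... | yes a≡b = contradiction a≡b a≢b
  ... | no _    = here refl
  winner-∈ L a≢b (there (there s∈L)) = there s∈L

  ∈-dedup : ∀ {s a b : ℕ} L → a ≡ b → s ∈ a ∷ b ∷ L → s ∈ a ∷ L
  ∈-dedup L a≡b (here s≡a)          = here s≡a
  ∈-dedup L a≡b (there (here s≡b))  = here (trans s≡b (sym a≡b))
  ∈-dedup L a≡b (there (there s∈L)) = there s∈L

  knockout-correct : ∀ {s} a L → s ∈ a ∷ L → All Valid (a ∷ L) →
                     run (knockout a L) (O s) ≡ s × cost (knockout a L) (O s) ≤ length L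
  knockout-correct a [] (here refl) _ = refl , z≤n
  knockout-correct {s} a (b ∷ L) s∈ (va ∷ vb ∷ vL) with distinguisher? a b
  ... | yes (x , a≢b) =
    let run≡s , cost≤ = knockout-correct (winner a b x (O s x)) L (winner-∈ L a≢b s∈)
                                         (winner-valid x (O s x) va vb ∷ vL)
        next = λ v → knockout (winner a b x v) L
    in trans (run-ask x next (O s)) run≡s , ≤-trans (≤-reflexive (cost-ask x next (O s))) (s≤s cost≤)
  ... | no no-distinguisher =
    let a≡b = O-injective va vb λ x → decidable-stable (O a x ≟ O b x) (no-distinguisher ∘ (x ,_))
        run≡s , cost≤ = knockout-correct a L (∈-dedup L a≡b s∈) (va ∷ vL)
    in run≡s , m≤n⇒m≤1+n cost≤

  tournament-correct : ∀ {s} C → s ∈ C → All Valid C →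
                       run (tournament C) (O s) ≡ s × cost (tournament C) (O s) ≤ length C
  tournament-correct (a ∷ L) s∈ vC =
    let run≡s , cost≤ = knockout-correct a L s∈ vC in run≡s , m≤n⇒m≤1+n cost≤

isqrt : ℕ → ℕ
isqrt zero = zero
isqrt (suc k) with suc (isqrt k) * suc (isqrt k) ≤? suc k
... | yes _ = suc (isqrt k)
... | no _  = isqrt k

isqrt-correct : ∀ k → isqrt k * isqrt k ≤ k × k < suc (isqrt k) * suc (isqrt k)
isqrt-correct zero = z≤n , s≤s z≤n
isqrt-correct (suc k) with isqrt-correct k | suc (isqrt k) * suc (isqrt k) ≤? suc k
... | _ , k<r² | yes r²≤k = r²≤k , ≤-trans (s≤s k<r²) (*-mono-< (n<1+n (suc (isqrt k))) (n<1+n (suc (isqrt k))))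
... | r²≤k , _ | no r²≰k  = m≤n⇒m≤1+n r²≤k , ≰⇒> r²≰k

isqrt-nonZero : ∀ k → .{{NonZero k}} → NonZero (isqrt k)
isqrt-nonZero k = >-nonZero (r≢0 (isqrt k) (proj₂ (isqrt-correct k)))
  where
  r≢0 : ∀ r → k < suc r * suc r → 0 < r
  r≢0 zero    k<1 = contradiction k<1 (≤⇒≯ (>-nonZero⁻¹ k))
  r≢0 (suc r) _   = z<s

<ᵇ-true : ∀ {m n} → m < n → (m <ᵇ n) ≡ true
<ᵇ-true {m} {n} m<n = det (<ᵇ-reflects-< m n) (ofʸ m<n)

<ᵇ-false : ∀ {m n} → n ≤ m → (m <ᵇ n) ≡ false
<ᵇ-false {m} {n} n≤m = det (<ᵇ-reflects-< m n) (ofⁿ (≤⇒≯ n≤m))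

+-<ᵇ-cancelˡ : ∀ s {x k} → (s + x <ᵇ s + k) ≡ (x <ᵇ k)
+-<ᵇ-cancelˡ zero    = refl
+-<ᵇ-cancelˡ (suc s) = +-<ᵇ-cancelˡ s

no-sampled-period : ∀ (g : ℕ → Bool) {N t} m b .{{_ : NonZero m}} .{{_ : NonZero b}} →
                    g t ≡ false → (∀ {y} → N ≤ y → g y ≡ true) →
                    ¬ (∀ j → j * b < N → g (t + j * b) ≡ g (t + m * b + j * b))
no-sampled-period g {N} {t} m b g[t]≡false g-high periodic =
  contradiction (trans (sym (g-high N≤far)) (false-along N)) λ ()
  where
  d : ℕ
  d = m * b

  N≤far : N ≤ t + N * d
  N≤far = ≤-trans (m≤m*n N d {{m*n≢0 m b}}) (m≤n+m (N * d) t)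

  next-multiple : ∀ t k m b → t + suc k * (m * b) ≡ t + m * b + k * m * b
  next-multiple = solve-∀

  false-along : ∀ k → g (t + k * d) ≡ false
  false-along zero = trans (cong g (+-identityʳ t)) g[t]≡false
  false-along (suc k) with k * m * b <? N
  ... | yes k*m*b<N = begin
    g (t + suc k * d)      ≡⟨ cong g (next-multiple t k m b) ⟩
    g (t + d + k * m * b)  ≡⟨ periodic (k * m) k*m*b<N ⟨
    g (t + k * m * b)      ≡⟨ cong (λ z → g (t + z)) (*-assoc k m b) ⟩
    g (t + k * d)          ≡⟨ false-along k ⟩
    false                  ∎
    where open ≡-Reasoning
  ... | no k*m*b≮N = contradiction (trans (sym (g-high N≤t+kd)) (false-along k)) λ ()
    where
    N≤t+kd : N ≤ t + k * d
    N≤t+kd = ≤-trans (≮⇒≥ k*m*b≮N) (≤-trans (≤-reflexive (*-assoc k m b)) (m≤n+m (k * d) t))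

fromMaybe-head-∈ : ∀ {A : Set} {x : A} d {xs} → x ∈ xs → fromMaybe d (head xs) ∈ xs
fromMaybe-head-∈ d (here _)  = here refl
fromMaybe-head-∈ d (there _) = here refl

All-fromMaybe-head : ∀ {A : Set} {P : A → Set} {d xs} → P d → All P xs → P (fromMaybe d (head xs))
All-fromMaybe-head Pd []       = Pd
All-fromMaybe-head Pd (Px ∷ _) = Px

fromMaybe-head-filter : ∀ {A : Set} {P : A → Set} (P? : Decidable P) d {x xs} → x ∈ xs → P x →
                        (∀ {y} → y ∈ xs → P y → y ≡ x) → fromMaybe d (head (filter P? xs)) ≡ x
fromMaybe-head-filter P? d x∈xs Px unique =
  let y∈xs , Py = ∈-filter⁻ P? (fromMaybe-head-∈ d (∈-filter⁺ P? x∈xs Px)) in unique y∈xs Py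

map-≡⇒≡ : ∀ {A B : Set} {f g : A → B} {x xs} → map f xs ≡ map g xs → x ∈ xs → f x ≡ g x
map-≡⇒≡ {xs = _ ∷ _} eq (here refl)  = proj₁ (∷-injective eq)
map-≡⇒≡ {xs = _ ∷ _} eq (there x∈xs) = map-≡⇒≡ (proj₂ (∷-injective eq)) x∈xs

[1+b]²≤[b+3]b : ∀ b → .{{NonZero b}} → suc b * suc b ≤ (b + 3) * b
[1+b]²≤[b+3]b (suc b) = ≤-trans (m≤m+n _ b) (≤-reflexive (expand b))
  where
  expand : ∀ b → suc (suc b) * suc (suc b) + b ≡ (suc b + 3) * suc b
  expand = solve-∀

square-bound : ∀ {q k} b → .{{NonZero b}} → b * b ≤ k → q ≤ b + 3 + b → q ^ 2 ≤ 25 * k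
square-bound {q} {k} b b²≤k q≤2b+3 = begin
  q * (q * 1)            ≤⟨ *-mono-≤ q≤5b (*-mono-≤ q≤5b ≤-refl) ⟩
  5 * b * (5 * b * 1)    ≡⟨ square b ⟩
  25 * (b * b)           ≤⟨ *-monoʳ-≤ 25 b²≤k ⟩
  25 * k                 ∎
  where
  open ≤-Reasoning
  square : ∀ b → 5 * b * (5 * b * 1) ≡ 25 * (b * b)
  square = solve-∀
  q≤5b : q ≤ 5 * b
  q≤5b = ≤-trans q≤2b+3 (≤-trans (+-monoˡ-≤ b (+-monoʳ-≤ b (m≤n*m 3 b))) (≤-reflexive (b+3b+b b)))
    where
    b+3b+b : ∀ b → b + b * 3 + b ≡ 5 * b
    b+3b+b = solve-∀

module ShiftFinding (c n : ℕ) (P : Vec Bool ((c ∸ 1) * n)) .{{_ : NonZero c}} .{{_ : NonZero n}} where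

  instance
    cn≢0 : NonZero (c * n)
    cn≢0 = m*n≢0 c n

  F : ℕ → Fin (c * n) → Bool
  F = oracle c n P

  F₀ : ℕ → Bool
  F₀ = shiftString c n P 0

  -- shiftString c n P s x unfolds to shape (x <ᵇ n ∸ s) (x ∸ (n ∸ s)).
  shape : Bool → ℕ → Bool
  shape below y = if below then false else if y <ᵇ (c ∸ 1) * n then vget P y else true

  F₀-low : ∀ {y} → y < n → F₀ y ≡ false
  F₀-low {y} y<n = cong (λ below → shape below (y ∸ n)) (<ᵇ-true y<n)

  F₀-high : ∀ {y} → c * n ≤ y → F₀ y ≡ true
  F₀-high {y} cn≤y = cong₂ (λ below inside → if below then false else if inside then vget P (y ∸ n) else true)
                            (<ᵇ-false n≤y) (<ᵇ-false [c∸1]n≤y∸n)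
    where
    n≤y : n ≤ y
    n≤y = ≤-trans (m≤n*m n c) cn≤y
    [c∸1]n≤y∸n : (c ∸ 1) * n ≤ y ∸ n
    [c∸1]n≤y∸n = begin
      (c ∸ 1) * n    ≡⟨ *-distribʳ-∸ n c 1 ⟩
      c * n ∸ 1 * n  ≡⟨ cong (c * n ∸_) (*-identityˡ n) ⟩
      c * n ∸ n      ≤⟨ ∸-monoˡ-≤ n cn≤y ⟩
      y ∸ n          ∎
      where open ≤-Reasoning

  shiftString-shift : ∀ {s} → s ≤ n → ∀ x → shiftString c n P s x ≡ F₀ (s + x)
  shiftString-shift {s} s≤n x = begin
    shape (x <ᵇ k) (x ∸ k)                   ≡⟨ cong₂ shape (+-<ᵇ-cancelˡ s) ([m+n]∸[m+o]≡n∸o s x k) ⟨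
    shape (s + x <ᵇ s + k) (s + x ∸ (s + k)) ≡⟨ cong (λ N → shape (s + x <ᵇ N) (s + x ∸ N)) (m+[n∸m]≡n s≤n) ⟩
    F₀ (s + x)                               ∎
    where
    open ≡-Reasoning
    k : ℕ
    k = n ∸ s

  F-fromℕ< : ∀ {s y} → s ≤ n → (y<cn : y < c * n) → F s (fromℕ< y<cn) ≡ F₀ (s + y)
  F-fromℕ< {s} s≤n y<cn =
    trans (shiftString-shift s≤n _) (cong (λ z → F₀ (s + z)) (toℕ-fromℕ< y<cn))

  F₀-aperiodic : ∀ {t} m b .{{_ : NonZero m}} .{{_ : NonZero b}} → t < n →
                 ¬ (∀ j → j * b < c * n → F₀ (t + j * b) ≡ F₀ (t + m * b + j * b))
  F₀-aperiodic m b t<n = no-sampled-period F₀ m b (F₀-low t<n) F₀-high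

  F-separates : ∀ {a b} → a < b → b ≤ n → ¬ (∀ x → F a x ≡ F b x)
  F-separates {a} {b} a<b b≤n Fa≗Fb =
    F₀-aperiodic (b ∸ a) 1 {{>-nonZero (m<n⇒0<n∸m a<b)}} (<-≤-trans a<b b≤n) agree
    where
    b≡a+[b∸a]1 : b ≡ a + (b ∸ a) * 1
    b≡a+[b∸a]1 = sym (trans (cong (a +_) (*-identityʳ (b ∸ a))) (m+[n∸m]≡n (<⇒≤ a<b)))
    agree : ∀ j → j * 1 < c * n → F₀ (a + j * 1) ≡ F₀ (a + (b ∸ a) * 1 + j * 1)
    agree j j1<cn = begin
      F₀ (a + j * 1)              ≡⟨ F-fromℕ< (≤-trans (<⇒≤ a<b) b≤n) j1<cn ⟨
      F a x                       ≡⟨ Fa≗Fb x ⟩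
      F b x                       ≡⟨ F-fromℕ< b≤n j1<cn ⟩
      F₀ (b + j * 1)              ≡⟨ cong (λ z → F₀ (z + j * 1)) b≡a+[b∸a]1 ⟩
      F₀ (a + (b ∸ a) * 1 + j * 1) ∎
      where
      open ≡-Reasoning
      x = fromℕ< j1<cn

  F-injective : ∀ {a b} → a ≤ n → b ≤ n → (∀ x → F a x ≡ F b x) → a ≡ b
  F-injective {a} {b} a≤n b≤n Fa≗Fb with <-cmp a b
  ... | tri< a<b _ _ = contradiction Fa≗Fb (F-separates a<b b≤n)
  ... | tri≈ _ a≡b _ = a≡b
  ... | tri> _ _ b<a = contradiction (sym ∘ Fa≗Fb) (F-separates b<a a≤n)

  open Tournament F (_≤ n) F-injective

  b : ℕ
  b = isqrt (c * n)

  instance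
    b≢0 : NonZero b
    b≢0 = isqrt-nonZero (c * n)

  position : ℕ → Fin (c * n)
  position j = (j * b) mod (c * n)

  positions : List (Fin (c * n))
  positions = applyUpTo position (b + 3)

  sample : ℕ → List Bool
  sample s = map (F s) positions

  Consistent : List Bool → ℕ → Set
  Consistent v t = t ≤ n × sample t ≡ v

  consistent? : ∀ v → Decidable (Consistent v)
  consistent? v t = (t ≤? n) ×-dec ≡-dec _≟_ (sample t) v

  residueClass : ℕ → List ℕ
  residueClass r = applyUpTo (λ q → r + q * b) (suc n)

  -- 0 is a filler for classes without a consistent shift; it is harmless as 0 ≤ n.
  candidate : List Bool → ℕ → ℕ
  candidate v r = fromMaybe 0 (head (filter (consistent? v) (residueClass r)))

  candidates : List Bool → List ℕ
  candidates v = map (candidate v) (upTo b)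

  algorithm : QTree (c * n)
  algorithm = queryAll positions (tournament ∘ candidates)

  all-multiples-sampled : ∀ {j} → j * b < c * n → j < b + 3
  all-multiples-sampled {j} jb<cn =
    *-cancelʳ-< b j (b + 3) (<-trans jb<cn (<-≤-trans (proj₂ (isqrt-correct (c * n))) ([1+b]²≤[b+3]b b)))

  F-position : ∀ {s} j → s ≤ n → j * b < c * n → F s (position j) ≡ F₀ (s + j * b)
  F-position {s} j s≤n jb<cn =
    trans (F-fromℕ< s≤n (m%n<n _ (c * n))) (cong (λ z → F₀ (s + z)) (m<n⇒m%n≡m jb<cn))

  sample-aperiodic : ∀ {t} m .{{_ : NonZero m}} → t + m * b ≤ n → sample t ≢ sample (t + m * b)
  sample-aperiodic {t} m t+mb≤n same = F₀-aperiodic m b t<n agree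
    where
    t<n : t < n
    t<n = <-≤-trans (m<m+n t (>-nonZero⁻¹ (m * b) {{m*n≢0 m b}})) t+mb≤n
    agree : ∀ j → j * b < c * n → F₀ (t + j * b) ≡ F₀ (t + m * b + j * b)
    agree j jb<cn = begin
      F₀ (t + j * b)          ≡⟨ F-position j (<⇒≤ t<n) jb<cn ⟨
      F t (position j)        ≡⟨ map-≡⇒≡ same (∈-applyUpTo⁺ position {i = j} (all-multiples-sampled jb<cn)) ⟩
      F (t + m * b) (position j) ≡⟨ F-position j t+mb≤n jb<cn ⟩
      F₀ (t + m * b + j * b)  ∎
      where open ≡-Reasoning

  consistent-class-< : ∀ {v} r {q q′} → q < q′ → Consistent v (r + q * b) → ¬ Consistent v (r + q′ * b)
  consistent-class-< {v} r {q} {q′} q<q′ (_ , sample≡v) (q′≤n , sample′≡v) =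
    sample-aperiodic (q′ ∸ q) {{>-nonZero (m<n⇒0<n∸m q<q′)}}
      (subst (_≤ n) split q′≤n) (trans sample≡v (sym (subst (λ t → sample t ≡ v) split sample′≡v)))
    where
    split : r + q′ * b ≡ r + q * b + (q′ ∸ q) * b
    split = begin
      r + q′ * b                  ≡⟨ cong (λ z → r + z * b) (m+[n∸m]≡n (<⇒≤ q<q′)) ⟨
      r + (q + (q′ ∸ q)) * b      ≡⟨ cong (r +_) (*-distribʳ-+ b q (q′ ∸ q)) ⟩
      r + (q * b + (q′ ∸ q) * b)  ≡⟨ +-assoc r (q * b) _ ⟨
      r + q * b + (q′ ∸ q) * b    ∎
      where open ≡-Reasoning

  consistent-class-unique : ∀ {v} r {q q′} → Consistent v (r + q * b) → Consistent v (r + q′ * b) → q ≡ q′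
  consistent-class-unique r {q} {q′} cq cq′ with <-cmp q q′
  ... | tri< q<q′ _ _ = contradiction cq′ (consistent-class-< r q<q′ cq)
  ... | tri≈ _ q≡q′ _ = q≡q′
  ... | tri> _ _ q′<q = contradiction cq (consistent-class-< r q′<q cq′)

  candidate-correct : ∀ {s} → s ≤ n → candidate (sample s) (s % b) ≡ s
  candidate-correct {s} s≤n = fromMaybe-head-filter (consistent? v) 0 s∈class (s≤n , refl) unique
    where
    v : List Bool
    v = sample s
    r : ℕ
    r = s % b
    s≡r+qb : s ≡ r + s / b * b
    s≡r+qb = m≡m%n+[m/n]*n s b
    s∈class : s ∈ residueClass r
    s∈class = subst (_∈ residueClass r) (sym s≡r+qb)
                (∈-applyUpTo⁺ (λ q → r + q * b) (s≤s (≤-trans (m/n≤m s b) s≤n)))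
    unique : ∀ {y} → y ∈ residueClass r → Consistent v y → y ≡ s
    unique y∈class y-consistent with ∈-applyUpTo⁻ (λ q → r + q * b) y∈class
    ... | q′ , _ , refl = trans (cong (λ q → r + q * b) q′≡s/b) (sym s≡r+qb)
      where
      q′≡s/b : q′ ≡ s / b
      q′≡s/b = consistent-class-unique r {q′} {s / b} y-consistent (subst (Consistent v) s≡r+qb (s≤n , refl))

  ∈-candidates : ∀ {s} → s ≤ n → s ∈ candidates (sample s)
  ∈-candidates {s} s≤n =
    subst (_∈ candidates (sample s)) (candidate-correct s≤n) (∈-map⁺ (candidate (sample s)) (∈-upTo⁺ (m%n<n s b)))

  candidates-valid : ∀ v → All (_≤ n) (candidates v)
  candidates-valid v = map⁺ (All.tabulate λ {r} _ →
    All-fromMaybe-head z≤n (All.map proj₁ (all-filter (consistent? v) (residueClass r))))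

  length-candidates : ∀ v → length (candidates v) ≡ b
  length-candidates v = trans (length-map (candidate v) (upTo b)) (length-upTo b)

  algorithm-correct : ∀ {s} → s ≤ n → run algorithm (F s) ≡ s × cost algorithm (F s) ≤ b + 3 + b
  algorithm-correct {s} s≤n
    with tournament-correct (candidates (sample s)) (∈-candidates s≤n) (candidates-valid (sample s))
  ... | run≡s , cost≤ = trans (run-queryAll positions _ (F s)) run≡s , (begin
    cost algorithm (F s)                                              ≡⟨ cost-queryAll positions _ (F s) ⟩
    length positions + cost (tournament (candidates (sample s))) (F s) ≤⟨ +-monoʳ-≤ (length positions) cost≤ ⟩
    length positions + length (candidates (sample s))                 ≡⟨ cong₂ _+_ (length-applyUpTo position (b + 3))
                                                                                     (length-candidates (sample s)) ⟩
    b + 3 + b                                                         ∎)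
    where open ≤-Reasoning

theorem1p8 : ∃ λ (K : ℕ) →
    (c n : ℕ) → 1 < c → 1 < n → (P : Vec Bool ((c ∸ 1) * n)) →
      ∃ λ (T : QTree (c * n)) →
        (s : ℕ) → s ≤ n →
          (run T (oracle c n P s) ≡ s) × (cost T (oracle c n P s) ^ 2 ≤ K * (c * n))
theorem1p8 = 25 , λ c n 1<c 1<n P →
  let open ShiftFinding c n P {{>-nonZero (<⇒≤ 1<c)}} {{>-nonZero (<⇒≤ 1<n)}}
  in algorithm , λ s s≤n →
       let run≡s , cost≤ = algorithm-correct s≤n
       in run≡s , square-bound b (proj₁ (isqrt-correct (c * n))) cost≤
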